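{- Let $u\le w$ in $\mathbb{P}^*$ under generalized factor order with $|u|=|w|$, and let $C: w=v_0\to\dots\to v_n=u$ be a maximal chain of $[u,w]$ with chain id $l_1\cdots l_n$. Then for each descent $v_i$ (that is, $l_i>l_{i+1}$), the singleton $\{v_i\}=C(v_{i-1},v_{i+1})$ is a minimally skipped interval of $C$, and these are all the minimally skipped intervals of $C$.
   Context: Generalized factor order on words over $\mathbb{P}=\{1,2,\dots\}$: $u\le w$ iff for some $i\ge0$, $u(j)\le w(i+j)$ for $1\le j\le|u|$. When $|u|=|w|$, $u\le w$ means $u(k)\le w(k)$ for all $k$. Chain ids. Each covering step lowers one letter by $1$, and $l_k$ is the position whose letter is lowered from $v_{k-1}$ to $v_k$. Maximal chains are ordered lexicographically by chain ids. Skipped intervals. $C(v_i,v_j)=\{v_{i+1},\dots,v_{j-1}\}$. A nonempty $C(v_i,v_j)$ is skipped if $C\setminus C(v_i,v_j)\subseteq C'$ for some lexicographically earlier maximal chain $C'$. It is minimally skipped if it properly contains no skipped interval. -}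

module Defs where

open import Data.Nat using (ℕ; zero; suc; _≤_; _<_; _>_; _≟_; pred)
open import Data.List using (List; []; _∷_; drop; map; upTo)
open import Data.Product using (Σ; _×_; ∃)
open import Data.Bool using (if_then_else_)
open import Relation.Nullary using (¬_)
open import Relation.Nullary.Decidable using (⌊_⌋)
open import Relation.Binary.PropositionalEquality using (_≡_)

-- Words over ℙ = {1,2,…}.  CONVENTION: a letter p ∈ ℙ is stored as the
-- natural number p - 1 (so the stored letter n stands for n+1).  This shift
-- is an order isomorphism ℕ ≅ ℙ, hence all order-theoretic notions below
-- (factor order, covers, chains, chain ids) are unchanged.
Word : Set
Word = List ℕ

data PrefixLE : Word → Word → Set where
  []≤  : ∀ {x} → PrefixLE [] x
  _∷≤_ : ∀ {a b u x} → a ≤ b → PrefixLE u x → PrefixLE (a ∷ u) (b ∷ x)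

_≼_ : Word → Word → Set
u ≼ w = Σ ℕ (λ i → PrefixLE u (drop i w))

_≺_ : Word → Word → Set
u ≺ w = u ≼ w × ¬ (u ≡ w)

InInterval : Word → Word → Word → Set
InInterval u w v = u ≼ v × v ≼ w

CoverIn : Word → Word → Word → Word → Set
CoverIn u w a b =
  InInterval u w a × InInterval u w b × b ≺ a ×
  ¬ (Σ Word (λ z → InInterval u w z × b ≺ z × z ≺ a))

record MaxChain (u w : Word) : Set where
  field
    len   : ℕ
    v     : ℕ → Word
    start : v 0 ≡ w
    end   : v len ≡ u
    step  : ∀ k → k < len → CoverIn u w (v k) (v (suc k))
open MaxChain public

-- first (1-based) position where two words differ; for a covering step
-- (which lowers exactly one letter by 1) this is the lowered position.
firstDiff : Word → Word → ℕ
firstDiff (a ∷ as) (b ∷ bs) = if ⌊ a ≟ b ⌋ then suc (firstDiff as bs) else 1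
firstDiff _ _ = 0

-- chain id letter l_k (k ≥ 1): position lowered from v_{k-1} to v_k
l : ∀ {u w} → MaxChain u w → ℕ → ℕ
l C k = firstDiff (v C (pred k)) (v C k)

chainId : ∀ {u w} → MaxChain u w → List ℕ
chainId C = map (λ k → firstDiff (v C k) (v C (suc k))) (upTo (len C))

data _<lex_ : List ℕ → List ℕ → Set where
  []<  : ∀ {y ys} → [] <lex (y ∷ ys)
  here : ∀ {x y xs ys} → x < y → (x ∷ xs) <lex (y ∷ ys)
  there : ∀ {x xs ys} → xs <lex ys → (x ∷ xs) <lex (x ∷ ys)

_⊏_ : ∀ {u w} → MaxChain u w → MaxChain u w → Set
C' ⊏ C = chainId C' <lex chainId C

_∈C_ : ∀ {u w} → Word → MaxChain u w → Set
x ∈C C = Σ ℕ (λ k → k ≤ len C × v C k ≡ x)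

InOpen : ∀ {u w} → MaxChain u w → ℕ → ℕ → Word → Set
InOpen C i j x = Σ ℕ (λ k → i < k × k < j × v C k ≡ x)

Skipped : ∀ {u w} → MaxChain u w → ℕ → ℕ → Set
Skipped {u} {w} C i j =
  i < j × j ≤ len C ×
  Σ Word (InOpen C i j) ×
  Σ (MaxChain u w) (λ C' → C' ⊏ C ×
     (∀ x → x ∈C C → ¬ InOpen C i j x → x ∈C C'))

ProperSub : ∀ {u w} → MaxChain u w → ℕ → ℕ → ℕ → ℕ → Set
ProperSub C i' j' i j =
  (∀ x → InOpen C i' j' x → InOpen C i j x) ×
  Σ Word (λ x → InOpen C i j x × ¬ InOpen C i' j' x)

MinSkipped : ∀ {u w} → MaxChain u w → ℕ → ℕ → Set
MinSkipped C i j =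
  Skipped C i j ×
  (∀ i' j' → ProperSub C i' j' i j → ¬ Skipped C i' j')

-- In an interval [u,w] with |u| = |w| the factor order is the componentwise order, so a cover
-- lowers one letter by one and the letter sum is a rank function: all maximal chains have the
-- same length, and a vertex has the same index in every chain containing it.  At a descent
-- l_i > l_{i+1} the two lowering steps commute; doing them in the other order gives a
-- lexicographically earlier chain that differs from C only at v_i, so {v_i} is skipped, and a
-- singleton is trivially minimal.  Conversely, if C(v_i,v_j) is skipped by C' then C' agrees
-- with C outside the interval, so its first deviation from C happens inside it and lowers a
-- position a smaller than the one C lowers there.  Without a descent inside, C only lowers
-- positions larger than a until v_j, so C' cannot rejoin C at v_j.  Hence every skipped
-- interval contains a descent, and minimality shrinks it to that descent.

module Submission where

open import Defs
open import Data.Nat using (ℕ; zero; suc; pred; _+_; _≤_; _<_; _>_; _≟_; _<?_; z≤n; z<s; s≤s; s≤s⁻¹)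
open import Data.Nat using (NonZero; >-nonZero; _≤′_; ≤′-refl; ≤′-step)
open import Data.Nat.Properties
open import Data.List using ([]; _∷_; length; applyUpTo)
open import Data.Nat.ListAction using (sum)
open import Function using (_∘_)
open import Data.List.Properties using (length-drop; ≡-dec; ∷-injectiveˡ; ∷-injectiveʳ; map-upTo)
open import Data.Product using (Σ; ∃-syntax; _×_; _,_; proj₁; proj₂)
open import Data.Empty using (⊥; ⊥-elim)
open import Relation.Nullary using (¬_; Dec; yes; no; contradiction)
open import Relation.Nullary.Decidable using (_×-dec_)
open import Relation.Binary.PropositionalEquality

private
  variable
    i j k m p q r : ℕ
    x y z : Word

PrefixLE-refl : ∀ x → PrefixLE x x
PrefixLE-refl []      = []≤
PrefixLE-refl (a ∷ x) = ≤-refl ∷≤ PrefixLE-refl x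

PrefixLE-trans : PrefixLE x y → PrefixLE y z → PrefixLE x z
PrefixLE-trans []≤          _            = []≤
PrefixLE-trans (a≤b ∷≤ x≤y) (b≤c ∷≤ y≤z) = ≤-trans a≤b b≤c ∷≤ PrefixLE-trans x≤y y≤z

PrefixLE⇒length≤ : PrefixLE x y → length x ≤ length y
PrefixLE⇒length≤ []≤         = z≤n
PrefixLE⇒length≤ (_ ∷≤ x≤y) = s≤s (PrefixLE⇒length≤ x≤y)

sum-mono-PrefixLE : PrefixLE x y → sum x ≤ sum y
sum-mono-PrefixLE []≤          = z≤n
sum-mono-PrefixLE (a≤b ∷≤ x≤y) = +-mono-≤ a≤b (sum-mono-PrefixLE x≤y)

sum-strictMono-PrefixLE : PrefixLE x y → length x ≡ length y → x ≢ y → sum x < sum y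
sum-strictMono-PrefixLE {[]}    {[]}    []≤ _ x≢y = contradiction refl x≢y
sum-strictMono-PrefixLE (_∷≤_ {a} {b} a≤b x≤y) |x|≡|y| ax≢by with a ≟ b
... | yes refl = +-monoʳ-< a (sum-strictMono-PrefixLE x≤y (suc-injective |x|≡|y|) (ax≢by ∘ cong (a ∷_)))
... | no a≢b   = +-mono-<-≤ (≤∧≢⇒< a≤b a≢b) (sum-mono-PrefixLE x≤y)

≼-length : x ≼ y → length x ≤ length y
≼-length {y = y} (i , x≤y) =
  ≤-trans (PrefixLE⇒length≤ x≤y) (≤-trans (≤-reflexive (length-drop i y)) (m∸n≤m _ i))

≼⇒PrefixLE : x ≼ y → length x ≡ length y → PrefixLE x y
≼⇒PrefixLE (zero , x≤y)                    _       = x≤y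
≼⇒PrefixLE {y = []}    (suc i , x≤y)       _       = x≤y
≼⇒PrefixLE {y = b ∷ y} (suc i , x≤y) |x|≡|y| =
  ⊥-elim (1+n≰n (subst (_≤ length y) |x|≡|y| (≼-length (i , x≤y))))

firstDiff-≡ : ∀ a x y → firstDiff (a ∷ x) (a ∷ y) ≡ suc (firstDiff x y)
firstDiff-≡ a x y with a ≟ a
... | yes _   = refl
... | no a≢a = contradiction refl a≢a

firstDiff-≢ : ∀ {a b} x y → a ≢ b → firstDiff (a ∷ x) (b ∷ y) ≡ 1
firstDiff-≢ {a} {b} x y a≢b with a ≟ b
... | yes a≡b = contradiction a≡b a≢b
... | no _    = refl

-- Positions are 1-based, as in firstDiff; positions out of range (in particular 0) are left
-- alone, and so is a letter 0, hence `lower p x ≢ x` says that p is a genuine lowering step.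
lower : ℕ → Word → Word
lower (suc zero)    (a ∷ x) = pred a ∷ x
lower (suc (suc p)) (a ∷ x) = a ∷ lower (suc p) x
lower _             x       = x

letter : ℕ → Word → ℕ
letter (suc zero)    (a ∷ x) = a
letter (suc (suc p)) (a ∷ x) = letter (suc p) x
letter _             _       = 0

lower-PrefixLE : ∀ p x → PrefixLE (lower p x) x
lower-PrefixLE zero          x       = PrefixLE-refl x
lower-PrefixLE (suc zero)    []      = []≤
lower-PrefixLE (suc (suc p)) []      = []≤
lower-PrefixLE (suc zero)    (a ∷ x) = pred[n]≤n ∷≤ PrefixLE-refl x
lower-PrefixLE (suc (suc p)) (a ∷ x) = ≤-refl ∷≤ lower-PrefixLE (suc p) x

sum-lower : ∀ p x → lower p x ≢ x → suc (sum (lower p x)) ≡ sum x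
sum-lower zero          x           lowers = contradiction refl lowers
sum-lower (suc zero)    []          lowers = contradiction refl lowers
sum-lower (suc (suc p)) []          lowers = contradiction refl lowers
sum-lower (suc zero)    (zero ∷ x)  lowers = contradiction refl lowers
sum-lower (suc zero)    (suc a ∷ x) lowers = refl
sum-lower (suc (suc p)) (a ∷ x)     lowers =
  trans (sym (+-suc a _)) (cong (a +_) (sum-lower (suc p) x (lowers ∘ cong (a ∷_))))

letter-lower : ∀ p x → lower p x ≢ x → suc (letter p (lower p x)) ≡ letter p x
letter-lower zero          x           lowers = contradiction refl lowers
letter-lower (suc zero)    []          lowers = contradiction refl lowers
letter-lower (suc (suc p)) []          lowers = contradiction refl lowers
letter-lower (suc zero)    (zero ∷ x)  lowers = contradiction refl lowers
letter-lower (suc zero)    (suc a ∷ x) lowers = refl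
letter-lower (suc (suc p)) (a ∷ x)     lowers = letter-lower (suc p) x (lowers ∘ cong (a ∷_))

firstDiff-lower : ∀ p x → lower p x ≢ x → firstDiff x (lower p x) ≡ p
firstDiff-lower zero          x           lowers = contradiction refl lowers
firstDiff-lower (suc zero)    []          lowers = contradiction refl lowers
firstDiff-lower (suc (suc p)) []          lowers = contradiction refl lowers
firstDiff-lower (suc zero)    (zero ∷ x)  lowers = contradiction refl lowers
firstDiff-lower (suc zero)    (suc a ∷ x) lowers = firstDiff-≢ x x 1+n≢n
firstDiff-lower (suc (suc p)) (a ∷ x)     lowers =
  trans (firstDiff-≡ a x _) (cong suc (firstDiff-lower (suc p) x (lowers ∘ cong (a ∷_))))

lower-comm : ∀ p q x → p ≢ q → lower p (lower q x) ≡ lower q (lower p x)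
lower-comm zero          q             x       p≢q = refl
lower-comm (suc p)       zero          x       p≢q = refl
lower-comm (suc zero)    (suc zero)    []      p≢q = refl
lower-comm (suc zero)    (suc (suc q)) []      p≢q = refl
lower-comm (suc (suc p)) (suc zero)    []      p≢q = refl
lower-comm (suc (suc p)) (suc (suc q)) []      p≢q = refl
lower-comm (suc zero)    (suc zero)    (a ∷ x) p≢q = contradiction refl p≢q
lower-comm (suc zero)    (suc (suc q)) (a ∷ x) p≢q = refl
lower-comm (suc (suc p)) (suc zero)    (a ∷ x) p≢q = refl
lower-comm (suc (suc p)) (suc (suc q)) (a ∷ x) p≢q =
  cong (a ∷_) (lower-comm (suc p) (suc q) x (p≢q ∘ cong suc))

letter-mono-PrefixLE : ∀ p → PrefixLE y x → letter p y ≤ letter p x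
letter-mono-PrefixLE zero          _            = z≤n
letter-mono-PrefixLE (suc zero)    []≤          = z≤n
letter-mono-PrefixLE (suc (suc p)) []≤          = z≤n
letter-mono-PrefixLE (suc zero)    (a≤b ∷≤ _)   = a≤b
letter-mono-PrefixLE (suc (suc p)) (_ ∷≤ y≤x)   = letter-mono-PrefixLE (suc p) y≤x

letter-firstDiff : ∀ p x y → p < firstDiff x y → letter p x ≡ letter p y
letter-firstDiff p (a ∷ x) (b ∷ y) p<fd with a ≟ b
letter-firstDiff zero          (a ∷ x) (a ∷ y) p<fd       | yes refl = refl
letter-firstDiff (suc zero)    (a ∷ x) (a ∷ y) p<fd       | yes refl = refl
letter-firstDiff (suc (suc p)) (a ∷ x) (a ∷ y) (s≤s p<fd) | yes refl = letter-firstDiff (suc p) x y p<fd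
letter-firstDiff zero          (a ∷ x) (b ∷ y) p<fd       | no _     = refl
letter-firstDiff (suc p)       (a ∷ x) (b ∷ y) (s≤s ())   | no _

PrefixLE-lower-firstDiff : PrefixLE y x → length y ≡ length x → y ≢ x →
  PrefixLE y (lower (firstDiff x y) x) × lower (firstDiff x y) x ≢ x
PrefixLE-lower-firstDiff {y = []} {x = []} []≤ _ y≢x = contradiction refl y≢x
PrefixLE-lower-firstDiff (_∷≤_ {a} {b} {y} {x} a≤b y≤x) |y|≡|x| ay≢bx with b ≟ a
... | no b≢a = lowerHead (≤∧≢⇒< a≤b (b≢a ∘ sym))
  where
  lowerHead : a < b → PrefixLE (a ∷ y) (pred b ∷ x) × pred b ∷ x ≢ b ∷ x
  lowerHead (s≤s a≤b-1) = (a≤b-1 ∷≤ y≤x) , 1+n≢n ∘ sym ∘ ∷-injectiveˡ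
... | yes refl with firstDiff x y | PrefixLE-lower-firstDiff y≤x (suc-injective |y|≡|x|) (ay≢bx ∘ cong (a ∷_))
...   | zero  | _ , lowers = contradiction refl lowers
...   | suc _ | y≤x' , lowers = (≤-refl ∷≤ y≤x') , lowers ∘ ∷-injectiveʳ

applyUpTo-<lex : ∀ (f g : ℕ → ℕ) {n} p → p < n → (∀ {q} → q < p → f q ≡ g q) → f p < g p →
  applyUpTo f n <lex applyUpTo g n
applyUpTo-<lex f g zero    (s≤s _)   _       fp<gp = here fp<gp
applyUpTo-<lex f g (suc p) (s≤s p<n) f≡g<p fp<gp rewrite f≡g<p (s≤s (z≤n {p})) =
  there (applyUpTo-<lex (f ∘ suc) (g ∘ suc) p p<n (f≡g<p ∘ s≤s) fp<gp)

applyUpTo-<lex⁻ : ∀ (f g : ℕ → ℕ) n → applyUpTo f n <lex applyUpTo g n →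
  ∃[ p ] p < n × (∀ {q} → q < p → f q ≡ g q) × f p < g p
applyUpTo-<lex⁻ f g n f<g = go f g n f<g refl refl
  where
  go : ∀ (f g : ℕ → ℕ) n {xs ys} → xs <lex ys → xs ≡ applyUpTo f n → ys ≡ applyUpTo g n →
    ∃[ p ] p < n × (∀ {q} → q < p → f q ≡ g q) × f p < g p
  go f g zero    ()         refl refl
  go f g (suc n) []<        ()   _
  go f g (suc n) (here x<y) xs≡  ys≡ =
    0 , s≤s z≤n , (λ ()) , subst₂ _<_ (∷-injectiveˡ xs≡) (∷-injectiveˡ ys≡) x<y
  go f g (suc n) (there xs<ys) xs≡ ys≡
    with go (f ∘ suc) (g ∘ suc) n xs<ys (∷-injectiveʳ xs≡) (∷-injectiveʳ ys≡)
  ... | p , p<n , f≡g<p , fp<gp = suc p , s≤s p<n , f≡g<1+p , fp<gp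
    where
    f≡g<1+p : ∀ {q} → q < suc p → f q ≡ g q
    f≡g<1+p {zero}  _         = trans (sym (∷-injectiveˡ xs≡)) (∷-injectiveˡ ys≡)
    f≡g<1+p {suc q} (s≤s q<p) = f≡g<p q<p

<-propagates-along-increasing : ∀ (f : ℕ → ℕ) {a} → (∀ {m} → p ≤ m → suc m < j → f m ≤ f (suc m)) →
  a < f p → p ≤′ q → q < j → a < f q
<-propagates-along-increasing f incr a<fp ≤′-refl          _     = a<fp
<-propagates-along-increasing f incr a<fp (≤′-step p≤′q) 1+q<j =
  <-≤-trans (<-propagates-along-increasing f incr a<fp p≤′q (<-trans (n<1+n _) 1+q<j))
            (incr (≤′⇒≤ p≤′q) 1+q<j)

chainId-applyUpTo : ∀ {u w} (C : MaxChain u w) → chainId C ≡ applyUpTo (λ k → l C (suc k)) (len C)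
chainId-applyUpTo C = map-upTo _ (len C)

Descent : ∀ {u w} → MaxChain u w → ℕ → Set
Descent C i = l C i > l C (suc i)

module _ {u w : Word} where

  ⊏-intro : (C′ C : MaxChain u w) → len C′ ≡ len C → p < len C →
    (∀ {q} → q < p → l C′ (suc q) ≡ l C (suc q)) → l C′ (suc p) < l C (suc p) → C′ ⊏ C
  ⊏-intro C′ C n′≡n p<n same-ids l′<l =
    subst₂ _<lex_ (sym (trans (chainId-applyUpTo C′) (cong (applyUpTo _) n′≡n))) (sym (chainId-applyUpTo C))
      (applyUpTo-<lex _ _ _ p<n same-ids l′<l)

  ⊏-firstDifference : (C′ C : MaxChain u w) → len C′ ≡ len C → C′ ⊏ C →
    ∃[ p ] p < len C × (∀ {q} → q < p → l C′ (suc q) ≡ l C (suc q)) × l C′ (suc p) < l C (suc p)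
  ⊏-firstDifference C′ C n′≡n C′⊏C = applyUpTo-<lex⁻ _ _ (len C)
    (subst₂ _<lex_ (trans (chainId-applyUpTo C′) (cong (applyUpTo _) n′≡n)) (chainId-applyUpTo C) C′⊏C)

  letter-chain-stable : ∀ {a} (C : MaxChain u w) → p ≤′ j → (∀ {q} → p ≤ q → q < j → a < l C (suc q)) →
    letter a (v C j) ≡ letter a (v C p)
  letter-chain-stable C ≤′-refl _ = refl
  letter-chain-stable {a = a} C (≤′-step {j} p≤′j) a<l =
    trans (sym (letter-firstDiff a (v C j) (v C (suc j)) (a<l (≤′⇒≤ p≤′j) ≤-refl)))
          (letter-chain-stable C p≤′j (λ p≤q q<j → a<l p≤q (m<n⇒m<1+n q<j)))

  InOpen-singleton : (C : MaxChain u w) → InOpen C k (suc (suc k)) x → v C (suc k) ≡ x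
  InOpen-singleton C (r , k<r , r<k+2 , vr≡x) = subst (λ r → v C r ≡ _) (≤-antisym (≤-pred r<k+2) k<r) vr≡x

  singleton-not-properly-skipped : (C : MaxChain u w) → ProperSub C i j k (suc (suc k)) → ¬ Skipped C i j
  singleton-not-properly-skipped C (sub , x , x∈ , x∉) (_ , _ , (y , y∈) , _) =
    x∉ (subst (InOpen C _ _) (trans (sym (InOpen-singleton C (sub y y∈))) (InOpen-singleton C x∈)) y∈)

replaceAt : ℕ → Word → (ℕ → Word) → ℕ → Word
replaceAt i y f k with k ≟ i
... | yes _ = y
... | no _  = f k

replaceAt-same : ∀ i y f → replaceAt i y f i ≡ y
replaceAt-same i y f with i ≟ i
... | yes _   = refl
... | no i≢i = contradiction refl i≢i

replaceAt-other : ∀ i y f → k ≢ i → replaceAt i y f k ≡ f k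
replaceAt-other {k} i y f k≢i with k ≟ i
... | yes k≡i = contradiction k≡i k≢i
... | no _    = refl

module EqualLength (u w : Word) (|u|≡|w| : length u ≡ length w) where

  length-∈ : InInterval u w x → length x ≡ length w
  length-∈ (u≼x , x≼w) = ≤-antisym (≼-length x≼w) (subst (_≤ _) |u|≡|w| (≼-length u≼x))

  length-≡-∈ : InInterval u w x → InInterval u w y → length y ≡ length x
  length-≡-∈ x∈ y∈ = trans (length-∈ y∈) (sym (length-∈ x∈))

  ∈⇒PrefixLE : InInterval u w x → PrefixLE u x × PrefixLE x w
  ∈⇒PrefixLE x∈@(u≼x , x≼w) =
    ≼⇒PrefixLE u≼x (trans |u|≡|w| (sym (length-∈ x∈))) , ≼⇒PrefixLE x≼w (length-∈ x∈)

  PrefixLE⇒∈ : PrefixLE u x → PrefixLE x w → InInterval u w x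
  PrefixLE⇒∈ u≤x x≤w = (0 , u≤x) , (0 , x≤w)

  ≼⇒PrefixLE-∈ : InInterval u w x → InInterval u w y → y ≼ x → PrefixLE y x
  ≼⇒PrefixLE-∈ x∈ y∈ y≼x = ≼⇒PrefixLE y≼x (length-≡-∈ x∈ y∈)

  sum-strictMono-∈ : InInterval u w x → InInterval u w y → y ≺ x → sum y < sum x
  sum-strictMono-∈ x∈ y∈ (y≼x , y≢x) =
    sum-strictMono-PrefixLE (≼⇒PrefixLE-∈ x∈ y∈ y≼x) (length-≡-∈ x∈ y∈) y≢x

  cover-strict : CoverIn u w x y → y ≢ x
  cover-strict (_ , _ , (_ , y≢x) , _) = y≢x

  cover⇒PrefixLE : CoverIn u w x y → PrefixLE y x
  cover⇒PrefixLE (x∈ , y∈ , (y≼x , _) , _) = ≼⇒PrefixLE-∈ x∈ y∈ y≼x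

  -- Lowering the first letter where y differs from x stays above y, so it is y or lies strictly between.
  cover⇒lower : CoverIn u w x y → y ≡ lower (firstDiff x y) x
  cover⇒lower {x} {y} (x∈ , y∈ , (y≼x , y≢x) , nothing-between)
    with PrefixLE-lower-firstDiff (≼⇒PrefixLE-∈ x∈ y∈ y≼x) (length-≡-∈ x∈ y∈) y≢x
  ... | y≤x′ , x′≢x with ≡-dec _≟_ y (lower (firstDiff x y) x)
  ...   | yes y≡x′ = y≡x′
  ...   | no y≢x′  =
    contradiction (_ , x′∈ , ((0 , y≤x′) , y≢x′) , ((0 , lower-PrefixLE _ x) , x′≢x)) nothing-between
    where
    x′∈ : InInterval u w (lower (firstDiff x y) x)
    x′∈ = PrefixLE⇒∈ (PrefixLE-trans (proj₁ (∈⇒PrefixLE y∈)) y≤x′)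
                     (PrefixLE-trans (lower-PrefixLE _ x) (proj₂ (∈⇒PrefixLE x∈)))

  cover-lowers : CoverIn u w x y → lower (firstDiff x y) x ≢ x
  cover-lowers x⋗y = cover-strict x⋗y ∘ trans (cover⇒lower x⋗y)

  sum-cover : CoverIn u w x y → suc (sum y) ≡ sum x
  sum-cover {x} x⋗y = trans (cong (suc ∘ sum) (cover⇒lower x⋗y)) (sum-lower _ x (cover-lowers x⋗y))

  lower⇒cover : ∀ p → InInterval u w x → InInterval u w (lower p x) → lower p x ≢ x → CoverIn u w x (lower p x)
  lower⇒cover {x} p x∈ x′∈ x′≢x = x∈ , x′∈ , ((0 , lower-PrefixLE p x) , x′≢x) , nothing-between
    where
    nothing-between : ¬ Σ Word (λ z → InInterval u w z × lower p x ≺ z × z ≺ x)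
    nothing-between (z , z∈ , x′≺z , z≺x) =
      <⇒≱ (sum-strictMono-∈ z∈ x′∈ x′≺z)
          (s≤s⁻¹ (subst (sum z <_) (sym (sum-lower p x x′≢x)) (sum-strictMono-∈ x∈ z∈ z≺x)))

  cover-swap : CoverIn u w x y → CoverIn u w y z → firstDiff x y ≢ firstDiff y z →
    CoverIn u w x (lower (firstDiff y z) x) × CoverIn u w (lower (firstDiff y z) x) z
  cover-swap {x} {y} {z} x⋗y@(x∈ , _ , _ , _) y⋗z@(_ , z∈ , _ , _) a≢b =
    lower⇒cover b x∈ y′∈ y′≢x ,
    subst (CoverIn u w y′) (sym z≡ay′) (lower⇒cover a y′∈ (subst (InInterval u w) z≡ay′ z∈) ay′≢y′)
    where
    open ≡-Reasoning
    a = firstDiff x y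
    b = firstDiff y z
    y′ = lower b x
    z≡ay′ : z ≡ lower a y′
    z≡ay′ = begin
      z                   ≡⟨ cover⇒lower y⋗z ⟩
      lower b y           ≡⟨ cong (lower b) (cover⇒lower x⋗y) ⟩
      lower b (lower a x) ≡⟨ lower-comm a b x a≢b ⟨
      lower a y′          ∎
    y′≢x : y′ ≢ x
    y′≢x y′≡x = cover-strict y⋗z (trans z≡ay′ (trans (cong (lower a) y′≡x) (sym (cover⇒lower x⋗y))))
    ay′≢y′ : lower a y′ ≢ y′
    ay′≢y′ ay′≡y′ = 1+n≢n (suc-injective (begin
      suc (suc (sum z)) ≡⟨ cong suc (sum-cover y⋗z) ⟩
      suc (sum y)       ≡⟨ sum-cover x⋗y ⟩
      sum x             ≡⟨ sum-lower b x y′≢x ⟨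
      suc (sum y′)      ≡⟨ cong (suc ∘ sum) (sym (trans z≡ay′ ay′≡y′)) ⟩
      suc (sum z)       ∎))
    y′∈ : InInterval u w y′
    y′∈ = PrefixLE⇒∈ (PrefixLE-trans (proj₁ (∈⇒PrefixLE z∈))
                                     (subst (λ t → PrefixLE t y′) (sym z≡ay′) (lower-PrefixLE a y′)))
                     (PrefixLE-trans (lower-PrefixLE b x) (proj₂ (∈⇒PrefixLE x∈)))

  chain-step : (C : MaxChain u w) → k < len C → v C (suc k) ≡ lower (l C (suc k)) (v C k)
  chain-step C k<n = cover⇒lower (step C _ k<n)

  letter-chain-step : (C : MaxChain u w) → k < len C →
    suc (letter (l C (suc k)) (v C (suc k))) ≡ letter (l C (suc k)) (v C k)
  letter-chain-step {k} C k<n =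
    trans (cong (suc ∘ letter (l C (suc k))) (chain-step C k<n))
          (letter-lower _ _ (cover-lowers (step C k k<n)))

  chain-antitone : (C : MaxChain u w) → q ≤′ r → r ≤ len C → PrefixLE (v C r) (v C q)
  chain-antitone C ≤′-refl              _   = PrefixLE-refl _
  chain-antitone C (≤′-step {r} q≤′r) r<n =
    PrefixLE-trans (cover⇒PrefixLE (step C r r<n)) (chain-antitone C q≤′r (<⇒≤ r<n))

  sum-chain : (C : MaxChain u w) → k ≤ len C → sum (v C k) + k ≡ sum w
  sum-chain {zero}  C _   = trans (+-identityʳ _) (cong sum (start C))
  sum-chain {suc k} C k<n = begin
    sum (v C (suc k)) + suc k   ≡⟨ +-suc _ k ⟩
    suc (sum (v C (suc k))) + k ≡⟨ cong (_+ k) (sum-cover (step C k k<n)) ⟩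
    sum (v C k) + k             ≡⟨ sum-chain C (<⇒≤ k<n) ⟩
    sum w                       ∎
    where open ≡-Reasoning

  len-unique : (C C′ : MaxChain u w) → len C ≡ len C′
  len-unique C C′ = +-cancelˡ-≡ (sum u) _ _ (trans (sum-end C) (sym (sum-end C′)))
    where
    sum-end : (C : MaxChain u w) → sum u + len C ≡ sum w
    sum-end C = trans (cong (λ x → sum x + len C) (sym (end C))) (sum-chain C ≤-refl)

  index-unique : (C C′ : MaxChain u w) → k ≤ len C → m ≤ len C′ → v C k ≡ v C′ m → k ≡ m
  index-unique {k} {m} C C′ k≤n m≤n′ vk≡vm = +-cancelˡ-≡ (sum (v C k)) _ _
    (trans (sum-chain C k≤n) (sym (trans (cong (λ x → sum x + m) vk≡vm) (sum-chain C′ m≤n′))))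

  same-ids⇒same-vertices : (C′ C : MaxChain u w) → p ≤ len C′ → p ≤ len C →
    (∀ {q} → q < p → l C′ (suc q) ≡ l C (suc q)) → v C′ p ≡ v C p
  same-ids⇒same-vertices {zero}  C′ C _     _    _        = trans (start C′) (sym (start C))
  same-ids⇒same-vertices {suc p} C′ C p<n′ p<n same-ids = begin
    v C′ (suc p)                  ≡⟨ chain-step C′ p<n′ ⟩
    lower (l C′ (suc p)) (v C′ p) ≡⟨ cong₂ lower (same-ids ≤-refl)
                                      (same-ids⇒same-vertices C′ C (<⇒≤ p<n′) (<⇒≤ p<n) (same-ids ∘ m<n⇒m<1+n)) ⟩
    lower (l C (suc p)) (v C p)   ≡⟨ chain-step C p<n ⟨
    v C (suc p)                   ∎
    where open ≡-Reasoning

  replaceVertex : (C : MaxChain u w) (k : ℕ) (y : Word) → suc k < len C →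
    CoverIn u w (v C k) y → CoverIn u w y (v C (suc (suc k))) → MaxChain u w
  replaceVertex C k y k+1<n x⋗y y⋗z = record
    { len   = len C
    ; v     = v′
    ; start = trans (unchanged (λ ())) (start C)
    ; end   = trans (unchanged (>⇒≢ k+1<n)) (end C)
    ; step  = step′
    }
    where
    v′ = replaceAt (suc k) y (v C)
    unchanged : r ≢ suc k → v′ r ≡ v C r
    unchanged = replaceAt-other (suc k) y (v C)
    step′ : ∀ j → j < len C → CoverIn u w (v′ j) (v′ (suc j))
    step′ j j<n = step-cases (j ≟ k) (j ≟ suc k)
      where
      step-cases : Dec (j ≡ k) → Dec (j ≡ suc k) → CoverIn u w (v′ j) (v′ (suc j))
      step-cases (yes refl) _ =
        subst₂ (CoverIn u w) (sym (unchanged (<⇒≢ (n<1+n k)))) (sym (replaceAt-same (suc k) y (v C))) x⋗y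
      step-cases (no _) (yes refl) =
        subst₂ (CoverIn u w) (sym (replaceAt-same (suc k) y (v C))) (sym (unchanged (>⇒≢ (n<1+n j)))) y⋗z
      step-cases (no j≢k) (no j≢k+1) =
        subst₂ (CoverIn u w) (sym (unchanged j≢k+1)) (sym (unchanged (j≢k ∘ suc-injective))) (step C j j<n)

  descent⇒skipped : (C : MaxChain u w) (k : ℕ) → suc k < len C → Descent C (suc k) →
    Skipped C k (suc (suc k))
  descent⇒skipped C k k+1<n desc =
    m<n⇒m<1+n (n<1+n k) , k+1<n , (v C (suc k) , suc k , ≤-refl , ≤-refl , refl) , C′ , C′⊏C , kept
    where
    open ≡-Reasoning
    k<n = <-trans (n<1+n k) k+1<n
    swapped = cover-swap (step C k k<n) (step C (suc k) k+1<n) (>⇒≢ desc)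
    C′ = replaceVertex C k _ k+1<n (proj₁ swapped) (proj₂ swapped)
    unchanged : r ≢ suc k → v C′ r ≡ v C r
    unchanged = replaceAt-other (suc k) _ (v C)
    C′⊏C : C′ ⊏ C
    C′⊏C = ⊏-intro C′ C refl k<n
      (λ q<k → cong₂ firstDiff (unchanged (<⇒≢ (m<n⇒m<1+n q<k))) (unchanged (<⇒≢ (s≤s q<k))))
      (subst (_< l C (suc k)) (sym l′≡) desc)
      where
      l′≡ : l C′ (suc k) ≡ l C (suc (suc k))
      l′≡ = begin
        l C′ (suc k)                                          ≡⟨ cong₂ firstDiff (unchanged (<⇒≢ (n<1+n k)))
                                                                                 (replaceAt-same (suc k) _ (v C)) ⟩
        firstDiff (v C k) (lower (l C (suc (suc k))) (v C k)) ≡⟨ firstDiff-lower _ _ (cover-strict (proj₁ swapped)) ⟩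
        l C (suc (suc k))                                     ∎
    kept : ∀ x → x ∈C C → ¬ InOpen C k (suc (suc k)) x → x ∈C C′
    kept x (r , r≤n , vr≡x) x∉ with r ≟ suc k
    ... | yes refl  = contradiction (r , ≤-refl , ≤-refl , vr≡x) x∉
    ... | no r≢k+1 = r , r≤n , trans (unchanged r≢k+1) vr≡x

  descent⇒minimallySkipped : (C : MaxChain u w) (k : ℕ) → suc k < len C → Descent C (suc k) →
    MinSkipped C k (suc (suc k))
  descent⇒minimallySkipped C k k+1<n desc =
    descent⇒skipped C k k+1<n desc , λ _ _ → singleton-not-properly-skipped C

  outside-unchanged : (C C′ : MaxChain u w) → j ≤ len C → (∀ x → x ∈C C → ¬ InOpen C i j x → x ∈C C′) →
    r ≤ len C → ¬ (i < r × r < j) → v C′ r ≡ v C r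
  outside-unchanged {j} {i} {r} C C′ j≤n kept r≤n r∉ with kept (v C r) (r , r≤n , refl) vr∉
    where
    vr∉ : ¬ InOpen C i j (v C r)
    vr∉ (q , i<q , q<j , vq≡vr) =
      r∉ (subst (λ q → i < q × q < j) (index-unique C C (≤-trans (<⇒≤ q<j) j≤n) r≤n vq≡vr) (i<q , q<j))
  ... | m , m≤n′ , vm≡vr = subst (λ m → v C′ m ≡ v C r) (index-unique C′ C m≤n′ r≤n vm≡vr) vm≡vr

  -- C′ lowers letter a at step p, but C only lowers later positions between v_p and v_j.
  cannot-rejoin : (C′ C : MaxChain u w) → p < j → j ≤ len C′ → v C′ p ≡ v C p → v C′ j ≡ v C j →
    (∀ {q} → p ≤ q → q < j → l C′ (suc p) < l C (suc q)) → ⊥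
  cannot-rejoin {p} {j} C′ C p<j j≤n′ vp≡ vj≡ a<l = <-irrefl refl (begin-strict
    letter a (v C j)        ≡⟨ cong (letter a) vj≡ ⟨
    letter a (v C′ j)       ≤⟨ letter-mono-PrefixLE a (chain-antitone C′ (≤⇒≤′ p<j) j≤n′) ⟩
    letter a (v C′ (suc p)) <⟨ ≤-reflexive (letter-chain-step C′ (<-≤-trans p<j j≤n′)) ⟩
    letter a (v C′ p)       ≡⟨ cong (letter a) vp≡ ⟩
    letter a (v C p)        ≡⟨ letter-chain-stable C (≤⇒≤′ (<⇒≤ p<j)) a<l ⟨
    letter a (v C j)        ∎)
    where
    open ≤-Reasoning
    a = l C′ (suc p)

  increasing-not-skipped : (C : MaxChain u w) → (∀ {m} → i < m → m < j → l C m ≤ l C (suc m)) → ¬ Skipped C i j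
  increasing-not-skipped {i} {j} C incr (_ , j≤n , _ , C′ , C′⊏C , kept)
    with ⊏-firstDifference C′ C (len-unique C′ C) C′⊏C
  ... | p , p<n , same-ids , l′<l =
    <-irrefl (cong₂ firstDiff vp≡ (unchanged p<n p+1-outside)) l′<l
    where
    unchanged : r ≤ len C → ¬ (i < r × r < j) → v C′ r ≡ v C r
    unchanged = outside-unchanged C C′ j≤n kept
    j≤n′ : j ≤ len C′
    j≤n′ = subst (j ≤_) (len-unique C C′) j≤n
    vp≡ : v C′ p ≡ v C p
    vp≡ = same-ids⇒same-vertices C′ C (subst (p ≤_) (len-unique C C′) (<⇒≤ p<n)) (<⇒≤ p<n) same-ids
    p+1-outside : ¬ (i < suc p × suc p < j)
    p+1-outside (i<p+1 , p+1<j) =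
      cannot-rejoin C′ C (<-trans (n<1+n p) p+1<j) j≤n′ vp≡ (unchanged j≤n (<-irrefl refl ∘ proj₂))
        (λ p≤q → <-propagates-along-increasing (λ q → l C (suc q))
                   (λ p≤m → incr (s≤s (≤-trans (s≤s⁻¹ i<p+1) p≤m))) l′<l (≤⇒≤′ p≤q))

  skipped-has-descent : (C : MaxChain u w) → Skipped C i j → ∃[ m ] i < m × m < j × Descent C m
  skipped-has-descent {i} {j} C skip with anyUpTo? (λ m → (i <? m) ×-dec (l C (suc m) <? l C m)) j
  ... | yes (m , m<j , i<m , desc) = m , i<m , m<j , desc
  ... | no no-descent =
    contradiction skip
      (increasing-not-skipped C (λ i<m m<j → ≮⇒≥ (λ desc → no-descent (_ , m<j , i<m , desc))))

  minimallySkipped-descent-unique : (C : MaxChain u w) → MinSkipped C i j → i < suc k → suc k < j →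
    Descent C (suc k) → i < r → r < j → r ≡ suc k
  minimallySkipped-descent-unique {i} {j} {k} {r} C ((_ , j≤n , _) , minimal) i<k+1 k+1<j desc i<r r<j
    with r ≟ suc k
  ... | yes r≡k+1 = r≡k+1
  ... | no r≢k+1  = contradiction (descent⇒skipped C k (<-≤-trans k+1<j j≤n) desc)
                      (minimal k (suc (suc k)) (inside , v C r , (r , i<r , r<j , refl) , vr∉))
    where
    inside : ∀ x → InOpen C k (suc (suc k)) x → InOpen C i j x
    inside x x∈ = suc k , i<k+1 , k+1<j , InOpen-singleton C x∈
    vr∉ : ¬ InOpen C k (suc (suc k)) (v C r)
    vr∉ vr∈ = r≢k+1 (sym (index-unique C C (<⇒≤ (<-≤-trans k+1<j j≤n)) (<⇒≤ (<-≤-trans r<j j≤n))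
                                         (InOpen-singleton C vr∈)))

  minimallySkipped⇒descent : (C : MaxChain u w) → MinSkipped C i j →
    Σ ℕ (λ m → 1 ≤ m × m < len C × l C m > l C (suc m) × suc i ≡ m × j ≡ suc m)
  minimallySkipped⇒descent {i} {j} C min-skip@(skip@(_ , j≤n , _) , _) with skipped-has-descent C skip
  ... | suc k , i<k+1 , k+1<j , desc =
    suc k , s≤s z≤n , <-≤-trans k+1<j j≤n , desc ,
    only (n<1+n i) (≤-<-trans i<k+1 k+1<j) ,
    trans (sym (suc-pred j)) (cong suc (only (<-≤-trans i<k+1 (pred-mono-≤ k+1<j)) j-1<j))
    where
    instance
      j-nonZero : NonZero j
      j-nonZero = >-nonZero (<-trans z<s k+1<j)
    j-1<j : pred j < j
    j-1<j = subst (pred j <_) (suc-pred j) (n<1+n (pred j))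
    only : i < r → r < j → r ≡ suc k
    only = minimallySkipped-descent-unique C min-skip i<k+1 k+1<j desc

proposition3p2 : (u w : Word) → u ≼ w → length u ≡ length w → (C : MaxChain u w) →
    ((i : ℕ) → 1 ≤ i → i < len C → l C i > l C (suc i) →
       (InOpen C (pred i) (suc i) (v C i) × ((x : Word) → InOpen C (pred i) (suc i) x → v C i ≡ x))
       × MinSkipped C (pred i) (suc i))
    × ((i j : ℕ) → MinSkipped C i j →
       Σ ℕ (λ m → 1 ≤ m × m < len C × l C m > l C (suc m) × suc i ≡ m × j ≡ suc m))
-- The hypothesis u ≼ w is implied by the existence of C.
proposition3p2 u w _ |u|≡|w| C = descents-minimallySkipped , λ _ _ → minimallySkipped⇒descent C
  where
  open EqualLength u w |u|≡|w|
  descents-minimallySkipped : (i : ℕ) → 1 ≤ i → i < len C → Descent C i →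
    (InOpen C (pred i) (suc i) (v C i) × ((x : Word) → InOpen C (pred i) (suc i) x → v C i ≡ x))
    × MinSkipped C (pred i) (suc i)
  descents-minimallySkipped (suc k) _ k+1<n desc =
    ((suc k , ≤-refl , ≤-refl , refl) , λ _ → InOpen-singleton C) , descent⇒minimallySkipped C k k+1<n desc
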